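{- Let $N=n_1+\cdots+n_k$, $\{0,1\}^N=\{0,1\}^{n_1}\times\cdots\times\{0,1\}^{n_k}$. For any $k$-wise layer $S=S_1\times\cdots\times S_k\subseteq\{0,1\}^N$, where $S_j=\{x\in\{0,1\}^{n_j}:|x|=w_j\}$ for $j\in[k]$, we have \[ r_N(S)=\sum_{j=1}^k\min\{w_j,n_j-w_j\}. \]
   Context: $|x|$ is the Hamming weight. Index complexity: for $T\subseteq\{0,1\}^N$, $r_N(T)=\min\{|I|:I\subseteq[N],\ \exists a\in T\text{ with } b_I\neq a_I\text{ for all } b\in T,\ b\ne a\}$, where $x_I=(x_i)_{i\in I}$. -}

module Defs where

open import Data.Nat using (ℕ; zero; suc; _+_; _≤_; _∸_; _⊓_)
open import Data.Bool using (Bool; true; false; if_then_else_)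
open import Data.Fin using (Fin; zero; suc; _↑ˡ_; _↑ʳ_)
open import Data.Fin.Subset using (Subset; _∈_; ∣_∣)
open import Data.Vec using (Vec; []; _∷_; sum; zipWith)
open import Data.Product using (Σ; _×_)
open import Data.Unit using (⊤)
open import Relation.Nullary using (¬_)
open import Relation.Binary.PropositionalEquality using (_≡_)

Point : ℕ → Set
Point N = Fin N → Bool

weight : {n : ℕ} → Point n → ℕ
weight {zero}  x = 0
weight {suc n} x = (if x zero then 1 else 0) + weight (λ i → x (suc i))

PointSet : ℕ → Set₁
PointSet N = Point N → Set

AgreeOn : {N : ℕ} → Subset N → Point N → Point N → Set
AgreeOn I x y = ∀ i → i ∈ I → x i ≡ y i

Identifies : {N : ℕ} → PointSet N → Subset N → Point N → Set
Identifies T I a =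
  T a × (∀ b → T b → ¬ (∀ i → b i ≡ a i) → ¬ AgreeOn I b a)

IndexComplexity : (N : ℕ) → PointSet N → ℕ → Set
IndexComplexity N T m =
  Σ (Subset N) (λ I → Σ (Point N) (λ a → Identifies T I a × ∣ I ∣ ≡ m))
  × (∀ (I : Subset N) (a : Point N) → Identifies T I a → m ≤ ∣ I ∣)

-- The k-wise layer S = S_1 × ... × S_k ⊆ {0,1}^N with N = n_1 + ... + n_k,
-- where block j of x consists of the consecutive n_j coordinates after the
-- first n_1 + ... + n_{j-1}, and S_j = {x ∈ {0,1}^{n_j} : |x| = w_j}.
Layer : {k : ℕ} → (ns ws : Vec ℕ k) → PointSet (sum ns)
Layer []       []       x = ⊤
Layer (n ∷ ns) (w ∷ ws) x =
  weight (λ i → x (i ↑ˡ sum ns)) ≡ w × Layer ns ws (λ i → x (n ↑ʳ i))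

layerFormula : {k : ℕ} → (ns ws : Vec ℕ k) → ℕ
layerFormula ns ws = sum (zipWith (λ n w → w ⊓ (n ∸ w)) ns ws)

-- Identification is compatible with products: J ++ K identifies the point
-- (a , c) of T ⊗ U exactly when J identifies a in T and K identifies c in U,
-- and |J ++ K| = |J| + |K|.  So everything reduces to a single slice
-- {x ∈ {0,1}^n : |x| = w}.  If J identifies a in the slice, then a is
-- constant off J: otherwise moving a one of a from an unseen coordinate to
-- another unseen coordinate yields a different point of the slice that J
-- cannot distinguish from a.  Hence J contains all ones of a (|J| ≥ w) or all
-- zeros of a (|J| ≥ n - w).  Conversely the support of a, and likewise its
-- zero set, identifies a: a point of the same weight lying above (below) a
-- on these coordinates is a itself.
module Submission where

open import Defs
open import Data.Nat using (ℕ; _≤_)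
open import Data.Fin using (Fin)
open import Data.Vec using (Vec; lookup; sum)

open import Function using (_∘_; const)
open import Data.Nat using (zero; suc; _+_; _∸_; _⊓_; z≤n; s≤s)
open import Data.Nat.Properties
  using (≤-trans; ≤-total; +-mono-≤; +-monoʳ-≤; +-comm; +-assoc; +-suc; +-cancelʳ-≡;
         m≤n+m; suc-injective; n≮n; m⊓n≤m; m⊓n≤n; m≤n⇒m⊓n≡m; m≥n⇒m⊓n≡n;
         m+n∸m≡n; m≤n+o⇒m∸n≤o; module ≤-Reasoning)
open import Data.Bool using (Bool; true; false; not; if_then_else_)
open import Data.Bool.Properties using (_≟_; ¬-not)
open import Data.Fin using (zero; suc; _↑ˡ_; _↑ʳ_)
open import Data.Fin.Properties using (any?)
open import Data.Fin.Subset using (Subset; _∈_; _∉_; ∣_∣)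
open import Data.Fin.Subset.Properties using (_∈?_; drop-there)
open import Data.Vec using ([]; _∷_; _++_; splitAt; tabulate)
import Data.Vec.Properties as Vec
open import Data.Vec.Functional using (updateAt) renaming (_++_ to _++ᶠ_)
open import Data.Vec.Functional.Properties
  using (updateAt-updates; updateAt-minimal; lookup-++ˡ; lookup-++ʳ)
open import Data.Product using (Σ-syntax; _×_; _,_; proj₁; proj₂)
open import Data.Sum using (_⊎_; inj₁; inj₂)
open import Data.Unit using (tt)
open import Data.Empty using (⊥-elim)
open import Relation.Nullary using (¬_; yes; no; ¬?)
open import Relation.Nullary.Decidable using (_×-dec_)
open import Relation.Binary.Definitions using (_Respects_)
open import Relation.Binary.PropositionalEquality

private variable
  k n m w : ℕ

↑-elim : ∀ n {m} {P : Fin (n + m) → Set} →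
         (∀ i → P (i ↑ˡ m)) → (∀ j → P (n ↑ʳ j)) → ∀ x → P x
↑-elim zero    left right x       = right x
↑-elim (suc n) left right zero    = left zero
↑-elim (suc n) left right (suc x) = ↑-elim n (left ∘ suc) right x

module _ (J : Subset n) (K : Subset m) where

  ∈-++⁺ˡ : ∀ {i} → i ∈ J → (i ↑ˡ m) ∈ J ++ K
  ∈-++⁺ˡ {i} i∈J = Vec.lookup⇒[]= _ (J ++ K) (trans (Vec.lookup-++ˡ J K i) (Vec.[]=⇒lookup i∈J))

  ∈-++⁺ʳ : ∀ {j} → j ∈ K → (n ↑ʳ j) ∈ J ++ K
  ∈-++⁺ʳ {j} j∈K = Vec.lookup⇒[]= _ (J ++ K) (trans (Vec.lookup-++ʳ J K j) (Vec.[]=⇒lookup j∈K))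

  ∈-++⁻ˡ : ∀ {i} → (i ↑ˡ m) ∈ J ++ K → i ∈ J
  ∈-++⁻ˡ {i} p = Vec.lookup⇒[]= i J (trans (sym (Vec.lookup-++ˡ J K i)) (Vec.[]=⇒lookup p))

  ∈-++⁻ʳ : ∀ {j} → (n ↑ʳ j) ∈ J ++ K → j ∈ K
  ∈-++⁻ʳ {j} p = Vec.lookup⇒[]= j K (trans (sym (Vec.lookup-++ʳ J K j)) (Vec.[]=⇒lookup p))

∣p++q∣≡∣p∣+∣q∣ : (J : Subset n) (K : Subset m) → ∣ J ++ K ∣ ≡ ∣ J ∣ + ∣ K ∣
∣p++q∣≡∣p∣+∣q∣ []          K = refl
∣p++q∣≡∣p∣+∣q∣ (true ∷ J)  K = cong suc (∣p++q∣≡∣p∣+∣q∣ J K)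
∣p++q∣≡∣p∣+∣q∣ (false ∷ J) K = ∣p++q∣≡∣p∣+∣q∣ J K

module _ (J : Subset n) (K : Subset m) {x y : Point (n + m)} where

  AgreeOn-++⁻ : AgreeOn (J ++ K) x y →
                AgreeOn J (x ∘ (_↑ˡ m)) (y ∘ (_↑ˡ m)) × AgreeOn K (x ∘ (n ↑ʳ_)) (y ∘ (n ↑ʳ_))
  AgreeOn-++⁻ agree = (λ i i∈J → agree _ (∈-++⁺ˡ J K i∈J)) , (λ j j∈K → agree _ (∈-++⁺ʳ J K j∈K))

  AgreeOn-++⁺ : AgreeOn J (x ∘ (_↑ˡ m)) (y ∘ (_↑ˡ m)) → AgreeOn K (x ∘ (n ↑ʳ_)) (y ∘ (n ↑ʳ_)) →
                AgreeOn (J ++ K) x y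
  AgreeOn-++⁺ agreeˡ agreeʳ = ↑-elim n {P = λ z → z ∈ J ++ K → x z ≡ y z}
    (λ i p → agreeˡ i (∈-++⁻ˡ J K p)) (λ j p → agreeʳ j (∈-++⁻ʳ J K p))

≗-++ᶠ : {z : Point (n + m)} {x : Point n} {y : Point m} →
        z ∘ (_↑ˡ m) ≗ x → z ∘ (n ↑ʳ_) ≗ y → z ≗ x ++ᶠ y
≗-++ᶠ {n} {x = x} {y} zˡ≗x zʳ≗y = ↑-elim n
  (λ i → trans (zˡ≗x i) (sym (lookup-++ˡ x y i)))
  (λ j → trans (zʳ≗y j) (sym (lookup-++ʳ x y j)))

bit : Bool → ℕ
bit b = if b then 1 else 0

bit≤1 : ∀ b → bit b ≤ 1
bit≤1 false = z≤n
bit≤1 true  = s≤s z≤n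

weight-cong : {x y : Point n} → x ≗ y → weight x ≡ weight y
weight-cong {zero}  x≗y = refl
weight-cong {suc n} x≗y = cong₂ _+_ (cong bit (x≗y zero)) (weight-cong (x≗y ∘ suc))

weight-not : (x : Point n) → weight x + weight (not ∘ x) ≡ n
weight-not {zero}  x = refl
weight-not {suc n} x with x zero
... | true  = cong suc (weight-not (x ∘ suc))
... | false = trans (+-suc _ _) (cong suc (weight-not (x ∘ suc)))

weight-updateAt : (x : Point n) (i : Fin n) (f : Bool → Bool) →
                  weight (updateAt x i f) + bit (x i) ≡ weight x + bit (f (x i))
weight-updateAt x zero f = begin
  bit (f x₀) + weight xs + bit x₀    ≡⟨ +-assoc (bit (f x₀)) _ _ ⟩
  bit (f x₀) + (weight xs + bit x₀)  ≡⟨ cong (bit (f x₀) +_) (+-comm (weight xs) _) ⟩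
  bit (f x₀) + (bit x₀ + weight xs)  ≡⟨ +-comm (bit (f x₀)) _ ⟩
  bit x₀ + weight xs + bit (f x₀)    ∎
  where open ≡-Reasoning
        x₀ = x zero
        xs = x ∘ suc
weight-updateAt x (suc i) f = begin
  bit x₀ + weight (updateAt xs i f) + bit (xs i)    ≡⟨ +-assoc (bit x₀) _ _ ⟩
  bit x₀ + (weight (updateAt xs i f) + bit (xs i))  ≡⟨ cong (bit x₀ +_) (weight-updateAt xs i f) ⟩
  bit x₀ + (weight xs + bit (f (xs i)))             ≡⟨ +-assoc (bit x₀) _ _ ⟨
  bit x₀ + weight xs + bit (f (xs i))               ∎
  where open ≡-Reasoning
        x₀ = x zero
        xs = x ∘ suc

infix 4 _⊑_
_⊑_ : Point n → Point n → Set
x ⊑ y = ∀ i → x i ≡ true → y i ≡ true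

weight-mono : {x y : Point n} → x ⊑ y → weight x ≤ weight y
weight-mono {zero}          x⊑y = z≤n
weight-mono {suc n} {x} {y} x⊑y with x zero in x₀ | y zero in y₀
... | true  | true  = s≤s (weight-mono (x⊑y ∘ suc))
... | true  | false with () ← trans (sym y₀) (x⊑y zero x₀)
... | false | _     = ≤-trans (weight-mono (x⊑y ∘ suc)) (m≤n+m _ _)

⊑∧weight≡⇒≗ : {x y : Point n} → x ⊑ y → weight y ≡ weight x → y ≗ x
⊑∧weight≡⇒≗ {suc n} {x} {y} x⊑y wy≡wx with x zero in x₀ | y zero in y₀
... | true  | true  = λ { zero    → trans y₀ (sym x₀)
                        ; (suc i) → ⊑∧weight≡⇒≗ (x⊑y ∘ suc) (suc-injective wy≡wx) i }
... | false | false = λ { zero    → trans y₀ (sym x₀)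
                        ; (suc i) → ⊑∧weight≡⇒≗ (x⊑y ∘ suc) wy≡wx i }
... | true  | false with () ← trans (sym y₀) (x⊑y zero x₀)
... | false | true  = ⊥-elim (n≮n _ (subst (_≤ weight (y ∘ suc)) (sym wy≡wx) (weight-mono (x⊑y ∘ suc))))

zeros-outside⇒weight≤∣∣ : (J : Subset n) {x : Point n} →
                          (∀ i → i ∉ J → x i ≡ false) → weight x ≤ ∣ J ∣
zeros-outside⇒weight≤∣∣ []          _ = z≤n
zeros-outside⇒weight≤∣∣ (true ∷ J)  {x} zeros =
  +-mono-≤ (bit≤1 (x zero)) (zeros-outside⇒weight≤∣∣ J (λ i i∉J → zeros (suc i) (i∉J ∘ drop-there)))
zeros-outside⇒weight≤∣∣ (false ∷ J) {x} zeros rewrite zeros zero (λ ()) =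
  zeros-outside⇒weight≤∣∣ J (λ i i∉J → zeros (suc i) (i∉J ∘ drop-there))

ones-outside⇒n≤weight+∣∣ : (J : Subset n) {x : Point n} →
                           (∀ i → i ∉ J → x i ≡ true) → n ≤ weight x + ∣ J ∣
ones-outside⇒n≤weight+∣∣ {n} J {x} ones = begin
  n                            ≡⟨ weight-not x ⟨
  weight x + weight (not ∘ x)  ≤⟨ +-monoʳ-≤ (weight x) (zeros-outside⇒weight≤∣∣ J not-zeros) ⟩
  weight x + ∣ J ∣             ∎
  where
  open ≤-Reasoning
  not-zeros : ∀ i → i ∉ J → not (x i) ≡ false
  not-zeros i i∉J = cong not (ones i i∉J)

firstOnes : ℕ → Point n
firstOnes zero    i       = false
firstOnes (suc w) zero    = true
firstOnes (suc w) (suc i) = firstOnes w i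

weight-firstOnes : w ≤ n → weight (firstOnes {n} w) ≡ w
weight-firstOnes {zero}  {zero}  _         = refl
weight-firstOnes {zero}  {suc n} _         = weight-firstOnes {zero} {n} z≤n
weight-firstOnes {suc w} {suc n} (s≤s w≤n) = cong suc (weight-firstOnes w≤n)

support : Point n → Subset n
support = tabulate

∈-support : {x : Point n} {i : Fin n} → x i ≡ true → i ∈ support x
∈-support {x = x} {i} xᵢ = Vec.lookup⇒[]= i (support x) (trans (Vec.lookup∘tabulate x i) xᵢ)

∣support∣≡weight : (x : Point n) → ∣ support x ∣ ≡ weight x
∣support∣≡weight {zero}  x = refl
∣support∣≡weight {suc n} x with x zero
... | true  = cong suc (∣support∣≡weight (x ∘ suc))
... | false = ∣support∣≡weight (x ∘ suc)

-- Layer (n ∷ ns) (w ∷ ws) is definitionally Slice n w ⊗ Layer ns ws.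
infixr 2 _⊗_
_⊗_ : PointSet n → PointSet m → PointSet (n + m)
_⊗_ {n} {m} T U x = T (x ∘ (_↑ˡ m)) × U (x ∘ (n ↑ʳ_))

Slice : (n w : ℕ) → PointSet n
Slice n w x = weight x ≡ w

Slice-respects : Slice n w Respects _≗_
Slice-respects x≗y wx = trans (sym (weight-cong x≗y)) wx

module _ {T : PointSet n} {U : PointSet m} (T-resp : T Respects _≗_) (U-resp : U Respects _≗_) where

  ⊗-respects : (T ⊗ U) Respects _≗_
  ⊗-respects x≗y (t , u) = T-resp (x≗y ∘ (_↑ˡ m)) t , U-resp (x≗y ∘ (n ↑ʳ_)) u

  ++ᶠ-∈-⊗ : {x : Point n} {y : Point m} → T x → U y → (T ⊗ U) (x ++ᶠ y)
  ++ᶠ-∈-⊗ {x} {y} t u = T-resp (sym ∘ lookup-++ˡ x y) t , U-resp (sym ∘ lookup-++ʳ x y) u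

  Identifies-⊗⁻ : {J : Subset n} {K : Subset m} {a : Point (n + m)} →
                  Identifies (T ⊗ U) (J ++ K) a →
                  Identifies T J (a ∘ (_↑ˡ m)) × Identifies U K (a ∘ (n ↑ʳ_))
  Identifies-⊗⁻ {J} {K} {a} ((aˡ∈T , aʳ∈U) , unique) = (aˡ∈T , uniqueˡ) , (aʳ∈U , uniqueʳ)
    where
    aˡ = a ∘ (_↑ˡ m)
    aʳ = a ∘ (n ↑ʳ_)

    uniqueˡ : ∀ b → T b → ¬ b ≗ aˡ → ¬ AgreeOn J b aˡ
    uniqueˡ b b∈T b≉aˡ agree = unique (b ++ᶠ aʳ) (++ᶠ-∈-⊗ b∈T aʳ∈U)
      (λ b++aʳ≗a → b≉aˡ (λ i → trans (sym (lookup-++ˡ b aʳ i)) (b++aʳ≗a (i ↑ˡ m))))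
      (AgreeOn-++⁺ J K (λ i i∈J → trans (lookup-++ˡ b aʳ i) (agree i i∈J)) (λ j _ → lookup-++ʳ b aʳ j))

    uniqueʳ : ∀ c → U c → ¬ c ≗ aʳ → ¬ AgreeOn K c aʳ
    uniqueʳ c c∈U c≉aʳ agree = unique (aˡ ++ᶠ c) (++ᶠ-∈-⊗ aˡ∈T c∈U)
      (λ aˡ++c≗a → c≉aʳ (λ j → trans (sym (lookup-++ʳ aˡ c j)) (aˡ++c≗a (n ↑ʳ j))))
      (AgreeOn-++⁺ J K (λ i _ → lookup-++ˡ aˡ c i) (λ j j∈K → trans (lookup-++ʳ aˡ c j) (agree j j∈K)))

  Identifies-⊗⁺ : {J : Subset n} {K : Subset m} {a : Point n} {c : Point m} →
                  Identifies T J a → Identifies U K c → Identifies (T ⊗ U) (J ++ K) (a ++ᶠ c)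
  Identifies-⊗⁺ {J} {K} {a} {c} (a∈T , uniqueˡ) (c∈U , uniqueʳ) = ++ᶠ-∈-⊗ a∈T c∈U , unique
    where
    unique : ∀ b → (T ⊗ U) b → ¬ b ≗ a ++ᶠ c → ¬ AgreeOn (J ++ K) b (a ++ᶠ c)
    unique b (bˡ∈T , bʳ∈U) b≉a++c agree with AgreeOn-++⁻ J K agree
    ... | agreeˡ , agreeʳ =
      uniqueˡ _ bˡ∈T (λ bˡ≗a → uniqueʳ _ bʳ∈U (λ bʳ≗c → b≉a++c (≗-++ᶠ bˡ≗a bʳ≗c))
                                 (λ j j∈K → trans (agreeʳ j j∈K) (lookup-++ʳ a c j)))
                     (λ i i∈J → trans (agreeˡ i i∈J) (lookup-++ˡ a c i))

Layer-respects : (ns ws : Vec ℕ k) → Layer ns ws Respects _≗_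
Layer-respects []       []       _ _ = tt
Layer-respects (n ∷ ns) (w ∷ ws)     = ⊗-respects Slice-respects (Layer-respects ns ws)

module _ {J : Subset n} {a : Point n} (ident : Identifies (Slice n w) J a) where

  one-outside⇒ones-outside : ∀ {i j} → i ∉ J → j ∉ J → a i ≡ true → a j ≡ true
  one-outside⇒ones-outside {i} {j} i∉J j∉J aᵢ with a j in aⱼ
  ... | true  = refl
  ... | false = ⊥-elim (proj₂ ident b b∈S b≉a agree)
    where
    -- moving a one of a from i to j keeps the weight and is invisible on J
    a′ = updateAt a j (const true)
    b  = updateAt a′ i (const false)

    i≢j : i ≢ j
    i≢j refl with () ← trans (sym aᵢ) aⱼ

    a′ᵢ : a′ i ≡ true
    a′ᵢ = trans (updateAt-minimal i j a i≢j) aᵢ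

    b≡a-off : ∀ l → l ≢ i → l ≢ j → b l ≡ a l
    b≡a-off l l≢i l≢j = trans (updateAt-minimal l i a′ l≢i) (updateAt-minimal l j a l≢j)

    b∈S : weight b ≡ w
    b∈S = trans (+-cancelʳ-≡ 1 (weight b) (weight a) (begin
      weight b + 1            ≡⟨ cong (λ v → weight b + bit v) a′ᵢ ⟨
      weight b + bit (a′ i)   ≡⟨ weight-updateAt a′ i (const false) ⟩
      weight a′ + 0           ≡⟨ cong (λ v → weight a′ + bit v) aⱼ ⟨
      weight a′ + bit (a j)   ≡⟨ weight-updateAt a j (const true) ⟩
      weight a + 1            ∎)) (proj₁ ident)
      where open ≡-Reasoning

    b≉a : ¬ b ≗ a
    b≉a b≗a with () ← trans (sym (updateAt-updates i a′)) (trans (b≗a i) aᵢ)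

    agree : AgreeOn J b a
    agree l l∈J = b≡a-off l (λ { refl → i∉J l∈J }) (λ { refl → j∉J l∈J })

  constant-outside : (∀ i → i ∉ J → a i ≡ false) ⊎ (∀ i → i ∉ J → a i ≡ true)
  constant-outside with any? (λ i → ¬? (i ∈? J) ×-dec a i ≟ true)
  ... | yes (i , i∉J , aᵢ) = inj₂ (λ j j∉J → one-outside⇒ones-outside i∉J j∉J aᵢ)
  ... | no  ∄one           = inj₁ (λ i i∉J → ¬-not (λ aᵢ → ∄one (i , i∉J , aᵢ)))

Slice-identifier-≥ : {J : Subset n} {a : Point n} → Identifies (Slice n w) J a → w ⊓ (n ∸ w) ≤ ∣ J ∣
Slice-identifier-≥ {n} {w} {J} {a} ident@(wa≡w , _) with constant-outside ident
... | inj₁ zeros = ≤-trans (m⊓n≤m w (n ∸ w)) (subst (_≤ ∣ J ∣) wa≡w (zeros-outside⇒weight≤∣∣ J zeros))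
... | inj₂ ones  = ≤-trans (m⊓n≤n w (n ∸ w))
                     (m≤n+o⇒m∸n≤o n w (subst (λ v → n ≤ v + ∣ J ∣) wa≡w (ones-outside⇒n≤weight+∣∣ J ones)))

module _ {a : Point n} (wa≡w : weight a ≡ w) where

  support-identifies : Identifies (Slice n w) (support a) a
  support-identifies = wa≡w , λ b wb≡w b≉a agree →
    b≉a (⊑∧weight≡⇒≗ (λ i aᵢ → trans (agree i (∈-support aᵢ)) aᵢ) (trans wb≡w (sym wa≡w)))

  cosupport-identifies : Identifies (Slice n w) (support (not ∘ a)) a
  cosupport-identifies = wa≡w , λ b wb≡w b≉a agree →
    b≉a (λ i → sym (⊑∧weight≡⇒≗ (b⊑a agree) (trans wa≡w (sym wb≡w)) i))
    where
    b⊑a : ∀ {b} → AgreeOn (support (not ∘ a)) b a → b ⊑ a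
    b⊑a agree i bᵢ with a i in aᵢ
    ... | true  = refl
    ... | false = trans (sym (trans (agree i (∈-support (cong not aᵢ))) aᵢ)) bᵢ

Slice-optimal-identifier : w ≤ n →
  Σ[ J ∈ Subset n ] Σ[ a ∈ Point n ] Identifies (Slice n w) J a × ∣ J ∣ ≡ w ⊓ (n ∸ w)
Slice-optimal-identifier {w} {n} w≤n with ≤-total w (n ∸ w)
... | inj₁ w≤n∸w = support a , a , support-identifies wa≡w ,
                   trans (∣support∣≡weight a) (trans wa≡w (sym (m≤n⇒m⊓n≡m w≤n∸w)))
  where
  a = firstOnes {n} w
  wa≡w = weight-firstOnes w≤n
... | inj₂ n∸w≤w = support (not ∘ a) , a , cosupport-identifies wa≡w ,
                   trans (∣support∣≡weight (not ∘ a)) (trans weight-zeros (sym (m≥n⇒m⊓n≡n n∸w≤w)))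
  where
  a = firstOnes {n} w
  wa≡w = weight-firstOnes w≤n
  weight-zeros : weight (not ∘ a) ≡ n ∸ w
  weight-zeros = trans (sym (m+n∸m≡n (weight a) _)) (cong₂ _∸_ (weight-not a) wa≡w)

Layer-identifier-≥ : (ns ws : Vec ℕ k) {I : Subset (sum ns)} {a : Point (sum ns)} →
                     Identifies (Layer ns ws) I a → layerFormula ns ws ≤ ∣ I ∣
Layer-identifier-≥ []       []       _ = z≤n
Layer-identifier-≥ (n ∷ ns) (w ∷ ws) {I} ident with splitAt n I
... | J , K , refl with Identifies-⊗⁻ Slice-respects (Layer-respects ns ws) {J} {K} ident
...   | identˡ , identʳ = subst (_ ≤_) (sym (∣p++q∣≡∣p∣+∣q∣ J K))
                            (+-mono-≤ (Slice-identifier-≥ identˡ) (Layer-identifier-≥ ns ws identʳ))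

Layer-optimal-identifier : (ns ws : Vec ℕ k) → (∀ j → lookup ws j ≤ lookup ns j) →
  Σ[ I ∈ Subset (sum ns) ] Σ[ a ∈ Point (sum ns) ] Identifies (Layer ns ws) I a × ∣ I ∣ ≡ layerFormula ns ws
Layer-optimal-identifier []       []       _   = [] , const false , (tt , λ _ _ b≉a _ → b≉a λ ()) , refl
Layer-optimal-identifier (n ∷ ns) (w ∷ ws) w≤n
  with Slice-optimal-identifier (w≤n zero) | Layer-optimal-identifier ns ws (w≤n ∘ suc)
... | J , a , identˡ , ∣J∣ | K , c , identʳ , ∣K∣ =
  J ++ K , a ++ᶠ c , Identifies-⊗⁺ Slice-respects (Layer-respects ns ws) identˡ identʳ ,
  trans (∣p++q∣≡∣p∣+∣q∣ J K) (cong₂ _+_ ∣J∣ ∣K∣)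

corollary1p42 : (k : ℕ) (ns ws : Vec ℕ k)
    → (∀ (j : Fin k) → lookup ws j ≤ lookup ns j)
    → IndexComplexity (sum ns) (Layer ns ws) (layerFormula ns ws)
corollary1p42 k ns ws w≤n = Layer-optimal-identifier ns ws w≤n , λ _ _ → Layer-identifier-≥ ns ws
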